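{- Let $\Gamma=\mathrm{Dic}(n,R,T)$ be a distance-regular dicirculant, with $\lambda$ the number of common neighbours of two adjacent vertices and $\mu$ the number of common neighbours of two vertices at distance $2$. Let $T_2=\{i\in\mathbb{Z}_{2n}: \alpha^i\beta \text{ is at distance } 2 \text{ from } 1 \text{ in } \Gamma\}$. Then $$|N(\alpha^i\beta)\cap \alpha^R|=|N(\alpha^i\beta)\cap \alpha^T\beta|=\begin{cases}\frac{\lambda}{2}, & \text{if } i\in T,\\ \frac{\mu}{2}, & \text{if } i\in T_2.\end{cases}$$ In particular, $\lambda$ is even, and $\mu$ is even whenever $T_2\neq\emptyset$.
   Context: $\mathrm{Dic}_n=\langle \alpha,\beta \mid \alpha^{2n}=1,\ \beta^2=\alpha^n,\ \beta^{ -1}\alpha\beta=\alpha^{ -1}\rangle$. For $R,T\subseteq\mathbb{Z}_{2n}$ with $0\notin R$, $R=-R$, $T=n+T$, $\mathrm{Dic}(n,R,T)$ is the Cayley graph $\mathrm{Cay}(\mathrm{Dic}_n,\alpha^R\cup\alpha^T\beta)$ with vertex set $\mathrm{Dic}_n$ and $g\sim h$ iff $g^{ -1}h\in\alpha^R\cup\alpha^T\beta$, where $\alpha^A=\{\alpha^a:a\in A\}$ and $\alpha^A\beta=\{\alpha^a\beta:a\in A\}$. $N(v)$ denotes the neighbourhood of $v$. Distance-regular: connected, and for vertices $u,v$ at distance $i$ the numbers of neighbours of $v$ at distance $i-1,i,i+1$ from $u$ depend only on $i$. -}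

module Defs where

open import Data.Nat using (ℕ; zero; suc; _+_; _*_; _∸_; _≤_; NonZero)
open import Data.Nat.DivMod using (_%_; m%n<n)
open import Data.Fin using (Fin; toℕ; fromℕ<)
open import Data.Fin.Subset using (Subset; _∈_)
open import Data.Bool using (Bool; true; false)
open import Data.Product using (_×_; _,_; Σ; ∃)
open import Data.Sum using (_⊎_)
open import Data.List using (List; length)
open import Data.List.Relation.Unary.Unique.Propositional using (Unique)
import Data.List.Membership.Propositional as LM
open import Function.Bundles using (_⇔_)
open import Relation.Binary.PropositionalEquality using (_≡_)

-- ℤ_{2n}, represented as Fin (n + n), with arithmetic modulo 2n.

Z : ℕ → Set
Z n = Fin (n + n)

nz2 : (n : ℕ) → .{{NonZero n}} → NonZero (n + n)
nz2 (suc n) = _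

modZ : (n : ℕ) → .{{NonZero n}} → ℕ → Z n
modZ n k = fromℕ< (m%n<n k (n + n) {{nz2 n}})
  where open import Data.Nat.DivMod using (m%n<n)

addZ : (n : ℕ) → .{{NonZero n}} → Z n → Z n → Z n
addZ n a b = modZ n (toℕ a + toℕ b)

negZ : (n : ℕ) → .{{NonZero n}} → Z n → Z n
negZ n a = modZ n ((n + n) ∸ toℕ a)

subZ : (n : ℕ) → .{{NonZero n}} → Z n → Z n → Z n
subZ n a b = addZ n a (negZ n b)

-- The dicyclic group Dic_n = ⟨α, β | α^{2n} = 1, β² = αⁿ, β⁻¹αβ = α⁻¹⟩.
-- The element (a , false) stands for α^a, and (a , true) for α^a β.
-- Every element is uniquely of one of these forms.

Dic : ℕ → Set
Dic n = Z n × Bool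

-- Multiplication, using β α^c = α^{-c} β and β² = αⁿ:
--   α^a     · α^c β^d = α^{a+c} β^d
--   α^a β   · α^c     = α^{a-c} β
--   α^a β   · α^c β   = α^{a-c+n}
mulD : (n : ℕ) → .{{NonZero n}} → Dic n → Dic n → Dic n
mulD n (a , false) (c , d)     = (addZ n a c , d)
mulD n (a , true)  (c , false) = (subZ n a c , true)
mulD n (a , true)  (c , true)  = (addZ n (subZ n a c) (modZ n n) , false)

invD : (n : ℕ) → .{{NonZero n}} → Dic n → Dic n
invD n (a , false) = (negZ n a , false)
invD n (a , true)  = (addZ n a (modZ n n) , true)

oneD : (n : ℕ) → .{{NonZero n}} → Dic n
oneD n = (modZ n 0 , false)

-- The dicirculant Dic(n,R,T) = Cay(Dic_n, α^R ∪ α^T β).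

InαR : (n : ℕ) → Subset (n + n) → Dic n → Set
InαR n R (a , false) = a ∈ R
InαR n R (a , true)  = Data.Empty.⊥
  where import Data.Empty

InαTβ : (n : ℕ) → Subset (n + n) → Dic n → Set
InαTβ n T (a , false) = Data.Empty.⊥
  where import Data.Empty
InαTβ n T (a , true)  = a ∈ T

Adj : (n : ℕ) → .{{NonZero n}} → Subset (n + n) → Subset (n + n) →
      Dic n → Dic n → Set
Adj n R T g h = InαR n R (mulD n (invD n g) h) ⊎ InαTβ n T (mulD n (invD n g) h)

module Graph {V : Set} (_∼_ : V → V → Set) where

  data Walk : V → V → ℕ → Set where
    here  : ∀ {u} → Walk u u 0
    there : ∀ {u v w k} → u ∼ v → Walk v w k → Walk u w (suc k)

  Dist : V → V → ℕ → Set
  Dist u v i = Walk u v i × (∀ j → Walk u v j → i ≤ j)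

  Connected : Set
  Connected = ∀ u v → ∃ λ k → Walk u v k

HasCard : {A : Set} → (A → Set) → ℕ → Set
HasCard {A} P c =
  Σ (List A) λ xs → Unique xs × (∀ x → (x LM.∈ xs) ⇔ P x) × length xs ≡ c

module DR {V : Set} (_∼_ : V → V → Set) where
  open Graph _∼_

  DistanceRegular : Set
  DistanceRegular =
    Connected ×
    Σ (ℕ → ℕ) λ c → Σ (ℕ → ℕ) λ a → Σ (ℕ → ℕ) λ b →
      (∀ u v i → Dist u v (suc i) →
         HasCard (λ w → (v ∼ w) × Dist u w i) (c (suc i))) ×
      (∀ u v i → Dist u v i →
         HasCard (λ w → (v ∼ w) × Dist u w i) (a i)) ×
      (∀ u v i → Dist u v i →
         HasCard (λ w → (v ∼ w) × Dist u w (suc i)) (b i))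

-- Since 1⁻¹ = 1, the neighbourhood of 1 is the connection set α^R ∪ α^Tβ, so the common
-- neighbours of 1 and x = αⁱβ split into N(x) ∩ α^R and N(x) ∩ α^Tβ.  Computing x⁻¹αᶜ and
-- x⁻¹αᶜβ gives αᶜ ∼ x ⇔ i − c ∈ T (using T = n + T) and αᶜβ ∼ x ⇔ i − c ∈ R, so the
-- involution αᶜ ↔ α^(i−c)β exchanges the two parts, and each has half of the λ (x ∼ 1) or
-- μ (d(1,x) = 2) common neighbours.  For the parity of λ note that a walk from 1 to β must use
-- an edge labelled by α^Tβ, so T ≠ ∅ and some αᵗβ is adjacent to 1.
module Submission where

open import Defs
open import Data.Nat using (ℕ; NonZero; _/_; _+_)
open import Data.Nat.Divisibility using (_∣_)
open import Data.Fin.Subset using (Subset; _∈_; _∉_)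
open import Data.Bool using (true)
open import Data.Product using (_×_; _,_; ∃)
open import Function.Bundles using (_⇔_)

open import Level using (0ℓ)
open import Algebra.Bundles using (AbelianGroup)
open import Algebra.Structures using (IsAbelianGroup)
import Algebra.Properties.AbelianGroup as AbelianGroupProperties
open import Data.Bool using (false; not)
open import Data.Bool.Properties using (not-involutive)
open import Data.Empty using (⊥-elim)
open import Data.Fin using (toℕ)
open import Data.Fin.Properties using (toℕ-fromℕ<; fromℕ<-cong; fromℕ<-toℕ; toℕ<n)
open import Data.Fin.Subset.Properties using (_∈?_)
open import Data.List using ([]; _∷_; length; filter; map)
open import Data.List.Properties using (length-map)
open import Data.List.Membership.Propositional using () renaming (_∈_ to _∈ˡ_)
open import Data.List.Membership.Propositional.Properties using (∈-filter⁺; ∈-filter⁻; ∈-map⁺; ∈-map⁻)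
open import Data.List.Membership.Propositional.Properties.WithK using (unique∧set⇒bag)
import Data.List.Relation.Unary.Unique.Propositional.Properties as Unique
open import Data.List.Relation.Binary.BagAndSetEquality using (∼bag⇒↭)
open import Data.List.Relation.Binary.Permutation.Propositional.Properties using (↭-length)
open import Data.Nat using (suc; _∸_; _*_; >-nonZero⁻¹)
open import Data.Nat.DivMod using (_%_; %-distribˡ-+; m%n%n≡m%n; n%n≡0; m<n⇒m%n≡m; m*n/n≡m)
open import Data.Nat.Divisibility using (m∣m*n)
open import Data.Nat.Properties using (+-comm; +-assoc; +-suc; +-identityʳ; *-comm; m∸n+n≡m; <⇒≤)
open import Data.Product using (∃₂; proj₂)
open import Data.Sum using (_⊎_; inj₁; inj₂)
open import Function.Bundles using (Equivalence; mk⇔)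
import Function.Properties.Equivalence as ⇔
open import Relation.Binary.PropositionalEquality
open import Relation.Nullary using (¬_; yes; no)
open import Relation.Unary using (Decidable)
open import Relation.Unary.Properties using (∁?)

module _ {A : Set} where

  HasCard-unique : ∀ {P : A → Set} {a b} → HasCard P a → HasCard P b → a ≡ b
  HasCard-unique (xs , xs! , xs⇔P , refl) (ys , ys! , ys⇔P , refl) =
    ↭-length (∼bag⇒↭ (unique∧set⇒bag xs! ys! λ {z} → ⇔.trans (xs⇔P z) (⇔.sym (ys⇔P z))))

  HasCard-resp-⇔ : ∀ {P Q : A → Set} {k} → (∀ x → P x ⇔ Q x) → HasCard P k → HasCard Q k
  HasCard-resp-⇔ P⇔Q (xs , xs! , xs⇔P , |xs|) = xs , xs! , (λ x → ⇔.trans (xs⇔P x) (P⇔Q x)) , |xs|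

  HasCard-inverse : ∀ {P Q : A → Set} {k} (f g : A → A) →
    (∀ x → g (f x) ≡ x) → (∀ y → f (g y) ≡ y) →
    (∀ x → P x → Q (f x)) → (∀ y → Q y → P (g y)) →
    HasCard P k → HasCard Q k
  HasCard-inverse {Q = Q} f g gf fg P⇒Qf Q⇒Pg (xs , xs! , xs⇔P , refl) =
    map f xs , Unique.map⁺ f-injective xs! , (λ y → mk⇔ (to y) (from y)) , length-map f xs
    where
    f-injective : ∀ {x y} → f x ≡ f y → x ≡ y
    f-injective {x} {y} fx≡fy = trans (sym (gf x)) (trans (cong g fx≡fy) (gf y))
    to : ∀ y → y ∈ˡ map f xs → Q y
    to y y∈ with ∈-map⁻ f y∈
    ... | x , x∈ , refl = P⇒Qf x (Equivalence.to (xs⇔P x) x∈)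
    from : ∀ y → Q y → y ∈ˡ map f xs
    from y Qy = subst (_∈ˡ map f xs) (fg y) (∈-map⁺ f (Equivalence.from (xs⇔P (g y)) (Q⇒Pg y Qy)))

  length-filter+length-filter-∁ : ∀ {Q : A → Set} (Q? : Decidable Q) xs →
    length (filter Q? xs) + length (filter (∁? Q?) xs) ≡ length xs
  length-filter+length-filter-∁ Q? [] = refl
  length-filter+length-filter-∁ Q? (x ∷ xs) with Q? x
  ... | yes _ = cong suc (length-filter+length-filter-∁ Q? xs)
  ... | no _  = trans (+-suc _ _) (cong suc (length-filter+length-filter-∁ Q? xs))

  HasCard-partition : ∀ {P Q : A → Set} {k} → Decidable Q → HasCard P k →
    ∃₂ λ a b → HasCard (λ x → P x × Q x) a × HasCard (λ x → P x × ¬ Q x) b × a + b ≡ k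
  HasCard-partition {P} Q? (xs , xs! , xs⇔P , refl) =
    _ , _ , restrict Q? , restrict (∁? Q?) , length-filter+length-filter-∁ Q? xs
    where
    restrict : ∀ {S : A → Set} (S? : Decidable S) → HasCard (λ x → P x × S x) (length (filter S? xs))
    restrict {S} S? = filter S? xs , Unique.filter⁺ S? xs! , (λ x → mk⇔ (to x) (from x)) , refl
      where
      to : ∀ x → x ∈ˡ filter S? xs → P x × S x
      to x x∈ with ∈-filter⁻ S? {xs = xs} x∈
      ... | x∈xs , Sx = Equivalence.to (xs⇔P x) x∈xs , Sx
      from : ∀ x → P x × S x → x ∈ˡ filter S? xs
      from x (Px , Sx) = ∈-filter⁺ S? (Equivalence.from (xs⇔P x) Px) Sx

[2*a]/2≡a : ∀ a → 2 * a / 2 ≡ a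
[2*a]/2≡a a = trans (cong (_/ 2) (*-comm 2 a)) (m*n/n≡m a 2)

module CyclicGroup (n : ℕ) .{{_ : NonZero n}} where

  private
    M : ℕ
    M = n + n

    instance
      M-nonZero : NonZero M
      M-nonZero = nz2 n

    %-absorbˡ : ∀ j k → (j % M + k) % M ≡ (j + k) % M
    %-absorbˡ j k = begin
      (j % M + k) % M           ≡⟨ %-distribˡ-+ (j % M) k M ⟩
      (j % M % M + k % M) % M   ≡⟨ cong (λ x → (x + k % M) % M) (m%n%n≡m%n j M) ⟩
      (j % M + k % M) % M       ≡⟨ %-distribˡ-+ j k M ⟨
      (j + k) % M               ∎
      where open ≡-Reasoning

    %-absorbʳ : ∀ j k → (j + k % M) % M ≡ (j + k) % M
    %-absorbʳ j k = begin
      (j + k % M) % M  ≡⟨ cong (_% M) (+-comm j (k % M)) ⟩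
      (k % M + j) % M  ≡⟨ %-absorbˡ k j ⟩
      (k + j) % M      ≡⟨ cong (_% M) (+-comm k j) ⟩
      (j + k) % M      ∎
      where open ≡-Reasoning

    0%M≡0 : 0 % M ≡ 0
    0%M≡0 = m<n⇒m%n≡m (>-nonZero⁻¹ M)

  toℕ-modZ : ∀ k → toℕ (modZ n k) ≡ k % M
  toℕ-modZ k = toℕ-fromℕ< _

  modZ-cong : ∀ {j k} → j % M ≡ k % M → modZ n j ≡ modZ n k
  modZ-cong eq = fromℕ<-cong _ _ eq _ _

  modZ-toℕ : ∀ a → modZ n (toℕ a) ≡ a
  modZ-toℕ a = trans (fromℕ<-cong _ _ (m<n⇒m%n≡m (toℕ<n a)) _ _) (fromℕ<-toℕ a (toℕ<n a))

  addZ-assoc : ∀ a b c → addZ n (addZ n a b) c ≡ addZ n a (addZ n b c)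
  addZ-assoc a b c = modZ-cong (begin
    (toℕ (modZ n (toℕ a + toℕ b)) + toℕ c) % M ≡⟨ cong (λ x → (x + toℕ c) % M) (toℕ-modZ _) ⟩
    ((toℕ a + toℕ b) % M + toℕ c) % M         ≡⟨ %-absorbˡ (toℕ a + toℕ b) (toℕ c) ⟩
    (toℕ a + toℕ b + toℕ c) % M               ≡⟨ cong (_% M) (+-assoc (toℕ a) (toℕ b) (toℕ c)) ⟩
    (toℕ a + (toℕ b + toℕ c)) % M             ≡⟨ %-absorbʳ (toℕ a) (toℕ b + toℕ c) ⟨
    (toℕ a + (toℕ b + toℕ c) % M) % M         ≡⟨ cong (λ x → (toℕ a + x) % M) (toℕ-modZ _) ⟨
    (toℕ a + toℕ (modZ n (toℕ b + toℕ c))) % M ∎)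
    where open ≡-Reasoning

  addZ-comm : ∀ a b → addZ n a b ≡ addZ n b a
  addZ-comm a b = cong (modZ n) (+-comm (toℕ a) (toℕ b))

  addZ-identityˡ : ∀ a → addZ n (modZ n 0) a ≡ a
  addZ-identityˡ a = trans (modZ-cong (begin
    (toℕ (modZ n 0) + toℕ a) % M ≡⟨ cong (λ x → (x + toℕ a) % M) (trans (toℕ-modZ 0) 0%M≡0) ⟩
    toℕ a % M ∎)) (modZ-toℕ a)
    where open ≡-Reasoning

  negZ-inverseˡ : ∀ a → addZ n (negZ n a) a ≡ modZ n 0
  negZ-inverseˡ a = modZ-cong (begin
    (toℕ (modZ n (M ∸ toℕ a)) + toℕ a) % M ≡⟨ cong (λ x → (x + toℕ a) % M) (toℕ-modZ _) ⟩
    ((M ∸ toℕ a) % M + toℕ a) % M          ≡⟨ %-absorbˡ (M ∸ toℕ a) (toℕ a) ⟩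
    (M ∸ toℕ a + toℕ a) % M                ≡⟨ cong (_% M) (m∸n+n≡m (<⇒≤ (toℕ<n a))) ⟩
    M % M                                  ≡⟨ n%n≡0 M ⟩
    0                                      ≡⟨ 0%M≡0 ⟨
    0 % M                                  ∎)
    where open ≡-Reasoning

  half-turn-involutive : addZ n (modZ n n) (modZ n n) ≡ modZ n 0
  half-turn-involutive = modZ-cong (begin
    (toℕ (modZ n n) + toℕ (modZ n n)) % M ≡⟨ cong₂ (λ x y → (x + y) % M) (toℕ-modZ n) (toℕ-modZ n) ⟩
    (n % M + n % M) % M                   ≡⟨ %-distribˡ-+ n n M ⟨
    M % M                                 ≡⟨ n%n≡0 M ⟩
    0                                     ≡⟨ 0%M≡0 ⟨
    0 % M                                 ∎)
    where open ≡-Reasoning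

  isAbelianGroup : IsAbelianGroup _≡_ (addZ n) (modZ n 0) (negZ n)
  isAbelianGroup = record
    { isGroup = record
      { isMonoid = record
        { isSemigroup = record
          { isMagma = record { isEquivalence = isEquivalence ; ∙-cong = cong₂ (addZ n) }
          ; assoc = addZ-assoc
          }
        ; identity = addZ-identityˡ , λ a → trans (addZ-comm a _) (addZ-identityˡ a)
        }
      ; inverse = negZ-inverseˡ , λ a → trans (addZ-comm a _) (negZ-inverseˡ a)
      ; ⁻¹-cong = cong (negZ n)
      }
    ; comm = addZ-comm
    }

  abelianGroup : AbelianGroup 0ℓ 0ℓ
  abelianGroup = record { isAbelianGroup = isAbelianGroup }

module DicyclicGroup (n : ℕ) .{{_ : NonZero n}} where

  open CyclicGroup n using (abelianGroup; half-turn-involutive)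
  open AbelianGroup abelianGroup using (_∙_; _⁻¹; _-_; ε; assoc; comm; identityˡ; identityʳ; ∙-congˡ)
  open AbelianGroupProperties abelianGroup using (ε⁻¹≈ε; ⁻¹-anti-homo‿-; //-rightDividesˡ)
  open ≡-Reasoning

  -- αʰ = β² is the central involution of Dic n.
  h : Z n
  h = modZ n n

  1⁻¹w≡w : ∀ w → mulD n (invD n (oneD n)) w ≡ w
  1⁻¹w≡w (c , d) = cong (_, d) (trans (cong (_∙ c) ε⁻¹≈ε) (identityˡ c))

  i-[i-c]≡c : ∀ i c → i - (i - c) ≡ c
  i-[i-c]≡c i c = begin
    i ∙ (i - c) ⁻¹  ≡⟨ ∙-congˡ (⁻¹-anti-homo‿- i c) ⟩
    i ∙ (c - i)     ≡⟨ comm i (c - i) ⟩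
    (c - i) ∙ i     ≡⟨ //-rightDividesˡ i c ⟩
    c               ∎

  [i+h]-c≡h+[i-c] : ∀ i c → (i ∙ h) - c ≡ h ∙ (i - c)
  [i+h]-c≡h+[i-c] i c = begin
    (i ∙ h) ∙ c ⁻¹  ≡⟨ cong (_∙ c ⁻¹) (comm i h) ⟩
    (h ∙ i) ∙ c ⁻¹  ≡⟨ assoc h i (c ⁻¹) ⟩
    h ∙ (i - c)     ∎

  [αⁱβ]⁻¹αᶜ≡αʰ⁺ⁱ⁻ᶜβ : ∀ i c → mulD n (invD n (i , true)) (c , false) ≡ (h ∙ (i - c) , true)
  [αⁱβ]⁻¹αᶜ≡αʰ⁺ⁱ⁻ᶜβ i c = cong (_, true) ([i+h]-c≡h+[i-c] i c)

  [αⁱβ]⁻¹αᶜβ≡αⁱ⁻ᶜ : ∀ i c → mulD n (invD n (i , true)) (c , true) ≡ (i - c , false)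
  [αⁱβ]⁻¹αᶜβ≡αⁱ⁻ᶜ i c = cong (_, false) (begin
    ((i ∙ h) - c) ∙ h  ≡⟨ cong (_∙ h) ([i+h]-c≡h+[i-c] i c) ⟩
    (h ∙ (i - c)) ∙ h  ≡⟨ cong (_∙ h) (comm h (i - c)) ⟩
    ((i - c) ∙ h) ∙ h  ≡⟨ assoc (i - c) h h ⟩
    (i - c) ∙ (h ∙ h)  ≡⟨ ∙-congˡ half-turn-involutive ⟩
    (i - c) ∙ ε        ≡⟨ identityʳ (i - c) ⟩
    i - c              ∎)

module Dicirculant (n : ℕ) .{{_ : NonZero n}} (R T : Subset (n + n))
                   (T-shift : ∀ a → a ∈ T ⇔ addZ n (modZ n n) a ∈ T) where

  open DicyclicGroup n
  open Graph (Adj n R T) using (Walk; there)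

  _∼_ : Dic n → Dic n → Set
  _∼_ = Adj n R T

  InS : Dic n → Set
  InS g = InαR n R g ⊎ InαTβ n T g

  ∼⇔∈S : ∀ g w {k} → mulD n (invD n g) w ≡ k → g ∼ w ⇔ InS k
  ∼⇔∈S g w refl = ⇔.refl

  1∼w⇔w∈S : ∀ w → oneD n ∼ w ⇔ InS w
  1∼w⇔w∈S w = ∼⇔∈S (oneD n) w (1⁻¹w≡w w)

  αⁱβ∼αᶜ⇔i-c∈T : ∀ i c → (i , true) ∼ (c , false) ⇔ subZ n i c ∈ T
  αⁱβ∼αᶜ⇔i-c∈T i c = ⇔.trans (∼⇔∈S (i , true) (c , false) ([αⁱβ]⁻¹αᶜ≡αʰ⁺ⁱ⁻ᶜβ i c))
    (mk⇔ (λ { (inj₁ ()) ; (inj₂ t) → Equivalence.from (T-shift _) t })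
         (λ t → inj₂ (Equivalence.to (T-shift _) t)))

  αⁱβ∼αᶜβ⇔i-c∈R : ∀ i c → (i , true) ∼ (c , true) ⇔ subZ n i c ∈ R
  αⁱβ∼αᶜβ⇔i-c∈R i c = ⇔.trans (∼⇔∈S (i , true) (c , true) ([αⁱβ]⁻¹αᶜβ≡αⁱ⁻ᶜ i c))
    (mk⇔ (λ { (inj₁ r) → r ; (inj₂ ()) }) inj₁)

  1∼αⁱβ : ∀ i → i ∈ T → oneD n ∼ (i , true)
  1∼αⁱβ i i∈T = Equivalence.from (1∼w⇔w∈S (i , true)) (inj₂ i∈T)

  N∩αᴿ N∩αᵀβ Common : Z n → Dic n → Set
  N∩αᴿ i w = (i , true) ∼ w × InαR n R w
  N∩αᵀβ i w = (i , true) ∼ w × InαTβ n T w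
  Common i w = oneD n ∼ w × (i , true) ∼ w

  mirror : Z n → Dic n → Dic n
  mirror i (c , d) = (subZ n i c , not d)

  mirror-involutive : ∀ i w → mirror i (mirror i w) ≡ w
  mirror-involutive i (c , d) = cong₂ _,_ (i-[i-c]≡c i c) (not-involutive d)

  mirror-N∩αᴿ : ∀ i w → N∩αᴿ i w → N∩αᵀβ i (mirror i w)
  mirror-N∩αᴿ i (c , false) (αⁱβ∼αᶜ , c∈R) =
    Equivalence.from (αⁱβ∼αᶜβ⇔i-c∈R i (subZ n i c)) (subst (_∈ R) (sym (i-[i-c]≡c i c)) c∈R) ,
    Equivalence.to (αⁱβ∼αᶜ⇔i-c∈T i c) αⁱβ∼αᶜ

  mirror-N∩αᵀβ : ∀ i w → N∩αᵀβ i w → N∩αᴿ i (mirror i w)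
  mirror-N∩αᵀβ i (c , true) (αⁱβ∼αᶜβ , c∈T) =
    Equivalence.from (αⁱβ∼αᶜ⇔i-c∈T i (subZ n i c)) (subst (_∈ T) (sym (i-[i-c]≡c i c)) c∈T) ,
    Equivalence.to (αⁱβ∼αᶜβ⇔i-c∈R i c) αⁱβ∼αᶜβ

  HasCard-N∩αᵀβ : ∀ i {k} → HasCard (N∩αᴿ i) k → HasCard (N∩αᵀβ i) k
  HasCard-N∩αᵀβ i = HasCard-inverse (mirror i) (mirror i)
    (mirror-involutive i) (mirror-involutive i) (mirror-N∩αᴿ i) (mirror-N∩αᵀβ i)

  InαR? : Decidable (InαR n R)
  InαR? (c , false) = c ∈? R
  InαR? (c , true)  = no λ ()

  αᵀβ∩αᴿ≡∅ : ∀ w → InαTβ n T w → ¬ InαR n R w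
  αᵀβ∩αᴿ≡∅ (c , true) _ ()

  Common∩αᴿ⇔N∩αᴿ : ∀ i w → (Common i w × InαR n R w) ⇔ N∩αᴿ i w
  Common∩αᴿ⇔N∩αᴿ i w = mk⇔
    (λ ((_ , αⁱβ∼w) , w∈αᴿ) → αⁱβ∼w , w∈αᴿ)
    (λ (αⁱβ∼w , w∈αᴿ) → (Equivalence.from (1∼w⇔w∈S w) (inj₁ w∈αᴿ) , αⁱβ∼w) , w∈αᴿ)

  Common∖αᴿ⇔N∩αᵀβ : ∀ i w → (Common i w × ¬ InαR n R w) ⇔ N∩αᵀβ i w
  Common∖αᴿ⇔N∩αᵀβ i w = mk⇔ to
    (λ (αⁱβ∼w , w∈αᵀβ) → (Equivalence.from (1∼w⇔w∈S w) (inj₂ w∈αᵀβ) , αⁱβ∼w) , αᵀβ∩αᴿ≡∅ w w∈αᵀβ)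
    where
    to : Common i w × ¬ InαR n R w → N∩αᵀβ i w
    to ((1∼w , αⁱβ∼w) , w∉αᴿ) with Equivalence.to (1∼w⇔w∈S w) 1∼w
    ... | inj₁ w∈αᴿ  = ⊥-elim (w∉αᴿ w∈αᴿ)
    ... | inj₂ w∈αᵀβ = αⁱβ∼w , w∈αᵀβ

  Common-halves : ∀ i {k} → HasCard (Common i) k →
    ∃ λ a → k ≡ 2 * a × HasCard (N∩αᴿ i) a × HasCard (N∩αᵀβ i) a
  Common-halves i {k} common with HasCard-partition InαR? common
  ... | a , b , common∩αᴿ , common∖αᴿ , a+b≡k = a , k≡2a , N∩αᴿ-card , HasCard-N∩αᵀβ i N∩αᴿ-card
    where
    N∩αᴿ-card : HasCard (N∩αᴿ i) a
    N∩αᴿ-card = HasCard-resp-⇔ (Common∩αᴿ⇔N∩αᴿ i) common∩αᴿ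
    b≡a : b ≡ a
    b≡a = HasCard-unique (HasCard-resp-⇔ (Common∖αᴿ⇔N∩αᵀβ i) common∖αᴿ)
                         (HasCard-N∩αᵀβ i N∩αᴿ-card)
    k≡2a : k ≡ 2 * a
    k≡2a = trans (sym a+b≡k) (cong (a +_) (trans b≡a (sym (+-identityʳ a))))

  Common-card⇒N∩-card : ∀ i {k} → HasCard (Common i) k →
    HasCard (N∩αᴿ i) (k / 2) × HasCard (N∩αᵀβ i) (k / 2)
  Common-card⇒N∩-card i common with Common-halves i common
  ... | a , refl , N∩αᴿ-card , N∩αᵀβ-card rewrite [2*a]/2≡a a = N∩αᴿ-card , N∩αᵀβ-card

  Common-card-even : ∀ i {k} → HasCard (Common i) k → 2 ∣ k
  Common-card-even i common with Common-halves i common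
  ... | a , refl , _ = m∣m*n a

  walk-αᵃ-αᵇβ⇒T-nonempty : ∀ {a b k} → Walk (a , false) (b , true) k → ∃ (_∈ T)
  walk-αᵃ-αᵇβ⇒T-nonempty (there {v = _ , false} _ walk)         = walk-αᵃ-αᵇβ⇒T-nonempty walk
  walk-αᵃ-αᵇβ⇒T-nonempty (there {v = _ , true} (inj₁ ()) _)
  walk-αᵃ-αᵇβ⇒T-nonempty (there {v = _ , true} (inj₂ c∈T) _)   = _ , c∈T

lemma3p3 : (n : ℕ) .{{_ : NonZero n}} (R T : Subset (n + n)) →
    modZ n 0 ∉ R →
    (∀ a → a ∈ R ⇔ negZ n a ∈ R) →
    (∀ a → a ∈ T ⇔ addZ n (modZ n n) a ∈ T) →
    DR.DistanceRegular (Adj n R T) →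
    (lam mu : ℕ) →
    (∀ u v → Adj n R T u v →
      HasCard (λ w → Adj n R T u w × Adj n R T v w) lam) →
    (∀ u v → Graph.Dist (Adj n R T) u v 2 →
      HasCard (λ w → Adj n R T u w × Adj n R T v w) mu) →
    (∀ i → i ∈ T →
      HasCard (λ w → Adj n R T (i , true) w × InαR n R w) (lam / 2) ×
      HasCard (λ w → Adj n R T (i , true) w × InαTβ n T w) (lam / 2)) ×
    (∀ i → Graph.Dist (Adj n R T) (oneD n) (i , true) 2 →
      HasCard (λ w → Adj n R T (i , true) w × InαR n R w) (mu / 2) ×
      HasCard (λ w → Adj n R T (i , true) w × InαTβ n T w) (mu / 2)) ×
    (2 ∣ lam) ×
    ((∃ λ i → Graph.Dist (Adj n R T) (oneD n) (i , true) 2) → 2 ∣ mu)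
-- 0 ∉ R and R = −R only make Γ a simple undirected graph; the counting does not need them.
lemma3p3 n R T _ _ T-shift (connected , _) lam mu λ-common μ-common =
    (λ i i∈T → Common-card⇒N∩-card i (λ-common (oneD n) (i , true) (1∼αⁱβ i i∈T)))
  , (λ i 1-αⁱβ-dist-2 → Common-card⇒N∩-card i (μ-common (oneD n) (i , true) 1-αⁱβ-dist-2))
  , 2∣λ
  , (λ (i , 1-αⁱβ-dist-2) → Common-card-even i (μ-common (oneD n) (i , true) 1-αⁱβ-dist-2))
  where
  open Dicirculant n R T T-shift
  2∣λ : 2 ∣ lam
  2∣λ with walk-αᵃ-αᵇβ⇒T-nonempty (proj₂ (connected (oneD n) (modZ n 0 , true)))
  ... | t , t∈T = Common-card-even t (λ-common (oneD n) (t , true) (1∼αⁱβ t t∈T))
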